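{- For $m\ge 1$ let $r(m)$ be the number of $\approx$-equivalence classes of two-layer comparator networks on $m$ channels whose first layer is $F_m=\{(2i-1,2i):1\le i\le\lfloor m/2\rfloor\}$. Then for every odd $n\ge 3$, $r(n)=r(n-1)+2\,r(n-2)$.
   Context: A comparator network on $m$ channels is a sequence of layers; each layer is a set of comparators $(i,j)$, $1\le i<j\le m$, with each channel in at most one comparator of the layer. A two-layer network is one with exactly two layers $L_1;L_2$ (layers may contain any number of comparators, including none). Graph representation: $\mathcal G(C)$ has one vertex per comparator; for a comparator $u$ in layer $k$ and a comparator $v$ in a later layer, there is an edge labeled $1$ (resp. $2$) from $u$ to $v$ if the channel carrying the minimum (resp. maximum) output of $u$, namely its smaller (resp. larger) channel, is used by $v$ and by no comparator in a layer strictly between those of $u$ and $v$. $C_1\approx C_2$ means $\mathcal G(C_1)$ and $\mathcal G(C_2)$ are isomorphic as edge-labeled directed graphs. -}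

module Defs where

open import Data.Nat using (ℕ; zero; suc; s≤s; z≤n)
open import Data.Fin using (Fin; zero; suc; toℕ)
import Data.Fin as F
open import Data.List using (List; []; _∷_; map; length; lookup)
open import Data.List.Relation.Unary.AllPairs using (AllPairs)
open import Data.Sum using (_⊎_; inj₁; inj₂)
open import Data.Product using (Σ; _×_; ∃)
open import Data.Empty using (⊥)
open import Relation.Nullary using (¬_)
open import Relation.Binary.PropositionalEquality using (_≡_)
open import Function.Bundles using (_↔_; Inverse; _⇔_)

-- Channels 1..m of the paper are Fin m (channel c of the paper is c - 1 here).

record Comparator (m : ℕ) : Set where
  constructor comp
  field
    lo    : Fin m
    hi    : Fin m
    lo<hi : lo F.< hi
open Comparator public

Uses : ∀ {m} → Comparator m → Fin m → Set
Uses c k = (lo c ≡ k) ⊎ (hi c ≡ k)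

ValidLayer : ∀ {m} → List (Comparator m) → Set
ValidLayer = AllPairs (λ c d → ∀ k → Uses c k → ¬ Uses d k)

record TwoLayer (m : ℕ) : Set where
  field
    L1 : List (Comparator m)
    L2 : List (Comparator m)
    valid1 : ValidLayer L1
    valid2 : ValidLayer L2
open TwoLayer public

-- vertices of G(C): one per comparator (first-layer ones, then second-layer ones)
Vertex : ∀ {m} → TwoLayer m → Set
Vertex C = Fin (length (L1 C)) ⊎ Fin (length (L2 C))

data Label : Set where
  one two : Label

-- labeled edges of G(C). In a two-layer network edges only go from layer 1
-- to layer 2 and no layer lies strictly between them.
Edge : ∀ {m} (C : TwoLayer m) → Vertex C → Vertex C → Label → Set
Edge C (inj₁ u) (inj₂ v) one = Uses (lookup (L2 C) v) (lo (lookup (L1 C) u))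
Edge C (inj₁ u) (inj₂ v) two = Uses (lookup (L2 C) v) (hi (lookup (L1 C) u))
Edge C _ _ _ = ⊥

_≈_ : ∀ {m} → TwoLayer m → TwoLayer m → Set
C ≈ D = Σ (Vertex C ↔ Vertex D) λ f →
  ∀ u v l → Edge C u v l ⇔ Edge D (Inverse.to f u) (Inverse.to f v) l

-- the first layer F_m = {(2i-1,2i) : 1 ≤ i ≤ ⌊m/2⌋}  (0-indexed: (2i,2i+1))
shift2 : ∀ {m} → Comparator m → Comparator (suc (suc m))
shift2 (comp i j p) = comp (suc (suc i)) (suc (suc j)) (s≤s (s≤s p))

Fm : (m : ℕ) → List (Comparator m)
Fm zero = []
Fm (suc zero) = []
Fm (suc (suc m)) = comp zero (suc zero) (s≤s z≤n) ∷ map shift2 (Fm m)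

NetF : ℕ → Set
NetF m = Σ (TwoLayer m) λ C → L1 C ≡ Fm m

-- ClassCount m k : the ≈-classes of networks in NetF m number exactly k,
-- witnessed by k pairwise inequivalent representatives covering all classes.
ClassCount : ℕ → ℕ → Set
ClassCount m k = Σ (Fin k → NetF m) λ rep →
  (∀ i j → Data.Product.proj₁ (rep i) ≈ Data.Product.proj₁ (rep j) → i ≡ j) ×
  (∀ (C : NetF m) → ∃ λ i → Data.Product.proj₁ C ≈ Data.Product.proj₁ (rep i))

module Submission where

-- Since the first layer is fixed to F_m, a network is determined by its second
-- layer X, and G(C) is the bipartite graph with an edge labelled l from the u-th
-- comparator of F_m (a "port") to every comparator of X using output l of u.  Such counts are
-- unique, as two systems of representatives inject into each other, and they
-- exist: ≃ is decidable by a search through permutations, and a finite list of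
-- candidate layers meets every class.
--
-- For n = 2t + 3 the last channel is the only one outside F_n.  Whether a
-- comparator uses it is visible in G(C): it then has a single input.  So the
-- classes split into those of layers avoiding the last channel, which are layers
-- on n - 1 channels (lift), and, for each label l, those whose comparator on the
-- last channel meets an output l (LastMeets l).  The latter arise exactly once
-- each by attaching a layer on n - 2 channels to a new first comparator
-- (attach l D).  The classes on n channels are thus indexed by
-- Fin r(n-1) ⊎ (Label × Fin r(n-2)), which has r(n-1) + 2 r(n-2) elements.

open import Defs
open import Level using (0ℓ)
open import Data.Nat using (ℕ; zero; suc; _+_; _*_; _∸_; _≤_; _<_; _%_; z≤n; s≤s; s≤s⁻¹)
import Data.Nat.Properties as ℕP
open import Data.Fin using (Fin; zero; suc; toℕ; fromℕ; fromℕ<; inject₁; lower₁; cast; punchIn; punchOut)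
import Data.Fin.Properties as FinP
open import Data.Fin.Permutation as Perm
  using ( Permutation; _⟨$⟩ʳ_; _⟨$⟩ˡ_; inverseʳ; inverseˡ; _∘ₚ_; lift₀; remove; lift₀-remove
        ; insert; insert-punchIn; insert-remove; ↔⇒≡)
import Data.Vec.Functional as Vector
open import Data.List using (List; []; _∷_; map; length; lookup; tabulate; concat; concatMap; cartesianProductWith; allFin; upTo; deduplicate)
import Data.List.Properties as ListP
import Data.List.Relation.Unary.All as All
import Data.List.Relation.Unary.All.Properties as AllP
open import Data.List.Relation.Unary.AllPairs as AllPairs using (AllPairs; []; _∷_)
import Data.List.Relation.Unary.AllPairs.Properties as AllPairsP
open import Data.List.Relation.Unary.Any as Any using (Any; here)
import Data.List.Relation.Unary.Any.Properties as AnyP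
import Data.List.Relation.Unary.Unique.DecSetoid.Properties as UniqueP
open import Data.List.Membership.Propositional using (_∈_)
open import Data.List.Membership.Propositional.Properties using (∈-lookup; ∈-allFin)
open import Data.Sum using (_⊎_; inj₁; inj₂)
import Data.Sum as Sum
open import Data.Sum.Properties using (inj₁-injective; inj₂-injective)
open import Data.Sum.Function.Propositional using (_⊎-↔_; _⊎-⇔_)
open import Data.Product using (Σ; _×_; _,_; proj₁; proj₂; ∃; uncurry)
open import Data.Product.Function.NonDependent.Propositional using (_×-↔_; _×-⇔_)
open import Data.Unit using (⊤; tt)
open import Data.Empty using (⊥; ⊥-elim)
open import Function using (_∘_; id)
open import Function.Definitions using (Injective)
open import Function.Bundles using (_↔_; Inverse; mk↔ₛ′; _⇔_; mk⇔; Equivalence)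
open import Function.Properties.Inverse using (↔-refl; ↔-sym; ↔-trans)
import Function.Properties.Equivalence as ⇔
open import Relation.Nullary using (¬_; Dec; yes; no; ¬?)
open import Relation.Nullary.Decidable using (map′; _×-dec_; _⊎-dec_; _→-dec_)
open import Relation.Binary.Bundles using (DecSetoid)
open import Relation.Binary.Definitions using (tri<; tri≈; tri>)
open import Relation.Binary.PropositionalEquality

open Equivalence using () renaming (to to ⇒; from to ⇐)

-- Doubling, recursing in the same way as the definition of F_m.
double : ℕ → ℕ
double zero = zero
double (suc x) = suc (suc (double x))

double-injective : ∀ {x y} → double x ≡ double y → x ≡ y
double-injective {zero} {zero} _ = refl
double-injective {suc x} {suc y} e = cong suc (double-injective (ℕP.suc-injective (ℕP.suc-injective e)))

double≢suc-double : ∀ x y → double x ≢ suc (double y)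
double≢suc-double zero y ()
double≢suc-double (suc x) zero ()
double≢suc-double (suc x) (suc y) e = double≢suc-double x y (ℕP.suc-injective (ℕP.suc-injective e))

-- Position of an output inside its comparator: the minimum sits on the
-- smaller channel (offset 0), the maximum on the larger one (offset 1).
offset : Label → ℕ
offset one = 0
offset two = 1

-- offset l + 2x is the position of output l of the x-th comparator of F_m.
offset-double-suc : ∀ l x → offset l + double (suc x) ≡ suc (suc (offset l + double x))
offset-double-suc one x = refl
offset-double-suc two x = refl

offset-double-injective : ∀ l l' {x y} → offset l + double x ≡ offset l' + double y → (l ≡ l') × (x ≡ y)
offset-double-injective one one e = refl , double-injective e
offset-double-injective one two e = ⊥-elim (double≢suc-double _ _ e)
offset-double-injective two one e = ⊥-elim (double≢suc-double _ _ (sym e))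
offset-double-injective two two e = refl , double-injective (ℕP.suc-injective e)

halve : ∀ x → Σ Label λ l → Σ ℕ λ q → x ≡ offset l + double q
halve zero = one , 0 , refl
halve (suc zero) = two , 0 , refl
halve (suc (suc x)) with halve x
... | l , q , e = l , suc q , trans (cong (λ z → suc (suc z)) e) (sym (offset-double-suc l q))

offset-double-< : ∀ l {x y} → x < y → offset l + double x < double y
offset-double-< one {zero} {suc y} _ = s≤s z≤n
offset-double-< two {zero} {suc y} _ = s≤s (s≤s z≤n)
offset-double-< l {suc x} {suc y} (s≤s x<y) rewrite offset-double-suc l x =
  s≤s (s≤s (offset-double-< l x<y))

offset-double-<⁻ : ∀ l x y → offset l + double x < double y → x < y
offset-double-<⁻ l x zero ()
offset-double-<⁻ l zero (suc y) _ = s≤s z≤n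
offset-double-<⁻ l (suc x) (suc y) lt rewrite offset-double-suc l x =
  s≤s (offset-double-<⁻ l x y (s≤s⁻¹ (s≤s⁻¹ lt)))

-- The output of a comparator carrying the minimum (label one) or maximum (two).
output : ∀ {m} → Label → Comparator m → Fin m
output one c = lo c
output two c = hi c

output-shift2 : ∀ {m} l (c : Comparator m) → output l (shift2 c) ≡ suc (suc (output l c))
output-shift2 one (comp i j p) = refl
output-shift2 two (comp i j p) = refl

-- pairs m = ⌊m/2⌋, the number of comparators of F_m.
pairs : ℕ → ℕ
pairs m = length (Fm m)

pairs-suc-suc : ∀ m → pairs (suc (suc m)) ≡ suc (pairs m)
pairs-suc-suc m = cong suc (ListP.length-map shift2 (Fm m))

pairs-double : ∀ t → pairs (double t) ≡ t
pairs-double zero = refl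
pairs-double (suc t) = trans (pairs-suc-suc (double t)) (cong suc (pairs-double t))

pairs-odd : ∀ t → pairs (suc (double t)) ≡ t
pairs-odd zero = refl
pairs-odd (suc t) = trans (pairs-suc-suc (suc (double t))) (cong suc (pairs-odd t))

-- All channels but possibly the last one belong to F_m.
pairs-bound : ∀ m → m ≤ suc (double (pairs m))
pairs-bound zero = z≤n
pairs-bound (suc zero) = s≤s z≤n
pairs-bound (suc (suc m)) rewrite ListP.length-map shift2 (Fm m) = s≤s (s≤s (pairs-bound m))

lookup-map : ∀ {A B : Set} (f : A → B) (xs : List A) (i : Fin (length (map f xs))) →
  lookup (map f xs) i ≡ f (lookup xs (cast (ListP.length-map f xs) i))
lookup-map f (x ∷ xs) zero = refl
lookup-map f (x ∷ xs) (suc i) = lookup-map f xs i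

-- The ports of F_m: output l of its u-th comparator, i.e. channel 2u + l.
port : ∀ m → Label → Fin (pairs m) → Fin m
port m l u = output l (lookup (Fm m) u)

-- F_(m+2) is the comparator on channels 0 and 1 followed by F_m shifted by two
-- channels; accordingly its ports are those of this comparator and the shifted ports of F_m.
first : ∀ {m} → Comparator (suc (suc m))
first = comp zero (suc zero) (s≤s z≤n)

stackedPort : ∀ m → Label → Fin (suc (pairs m)) → Fin (suc (suc m))
stackedPort m l zero = output l first
stackedPort m l (suc u) = suc (suc (port m l u))

port-suc-suc : ∀ m l u → port (suc (suc m)) l u ≡ stackedPort m l (cast (pairs-suc-suc m) u)
port-suc-suc m l zero = refl
port-suc-suc m l (suc u) = begin
  output l (lookup (map shift2 (Fm m)) u)   ≡⟨ cong (output l) (lookup-map shift2 (Fm m) u) ⟩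
  output l (shift2 (lookup (Fm m) _))      ≡⟨ output-shift2 l (lookup (Fm m) _) ⟩
  suc (suc (port m l _))                   ∎
  where open ≡-Reasoning

toℕ-port : ∀ m l u → toℕ (port m l u) ≡ offset l + double (toℕ u)
toℕ-port (suc (suc m)) one zero = refl
toℕ-port (suc (suc m)) two zero = refl
toℕ-port (suc (suc m)) l (suc u) = begin
  toℕ (port (suc (suc m)) l (suc u))        ≡⟨ cong toℕ (port-suc-suc m l (suc u)) ⟩
  suc (suc (toℕ (port m l u')))             ≡⟨ cong (λ z → suc (suc z)) (toℕ-port m l u') ⟩
  suc (suc (offset l + double (toℕ u')))    ≡⟨ sym (offset-double-suc l (toℕ u')) ⟩
  offset l + double (suc (toℕ u'))          ≡⟨ cong (λ z → offset l + double (suc z)) (FinP.toℕ-cast _ u) ⟩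
  offset l + double (toℕ (suc u))           ∎
  where
  open ≡-Reasoning
  u' = cast (ListP.length-map shift2 (Fm m)) u

port-injective : ∀ m {l l' u u'} → port m l u ≡ port m l' u' → (l ≡ l') × (u ≡ u')
port-injective m {l} {l'} {u} {u'} e
  with offset-double-injective l l' (trans (sym (toℕ-port m l u)) (trans (cong toℕ e) (toℕ-port m l' u')))
... | l≡l' , u≡u' = l≡l' , FinP.toℕ-injective u≡u'

port< : ∀ m l u → toℕ (port m l u) < double (pairs m)
port< m l u rewrite toℕ-port m l u = offset-double-< l (FinP.toℕ<n u)

port-surjective : ∀ m (k : Fin m) → toℕ k < double (pairs m) → Σ Label λ l → Σ (Fin (pairs m)) λ u → port m l u ≡ k
port-surjective m k k< with halve (toℕ k)
... | l , q , e = l , fromℕ< q< , FinP.toℕ-injective (begin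
    toℕ (port m l (fromℕ< q<))            ≡⟨ toℕ-port m l _ ⟩
    offset l + double (toℕ (fromℕ< q<))   ≡⟨ cong (λ z → offset l + double z) (FinP.toℕ-fromℕ< q<) ⟩
    offset l + double q                   ≡⟨ sym e ⟩
    toℕ k                                 ∎)
  where
  open ≡-Reasoning
  q< : q < pairs m
  q< = offset-double-<⁻ l q (pairs m) (subst (_< double (pairs m)) e k<)

-- The smaller channel of any comparator is a port (only the last channel of
-- an odd m is not a port, and it is never the smaller channel).
lo-port : ∀ {m} (c : Comparator m) → Σ Label λ l → Σ (Fin (pairs m)) λ u → port m l u ≡ lo c
lo-port {m} c = port-surjective m (lo c)
  (ℕP.<-≤-trans (lo<hi c) (s≤s⁻¹ (ℕP.≤-trans (FinP.toℕ<n (hi c)) (pairs-bound m))))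

-- The last channel of an odd number of channels, the only one outside F_m.
last : ∀ s → Fin (suc (double s))
last s = fromℕ (double s)

port≢last : ∀ s l u → port (suc (double s)) l u ≢ last s
port≢last s l u e = ℕP.<-irrefl (trans (cong toℕ e) (FinP.toℕ-fromℕ (double s)))
  (subst (λ z → toℕ (port (suc (double s)) l u) < double z) (pairs-odd s) (port< _ l u))

port-or-last : ∀ s (k : Fin (suc (double s))) → k ≢ last s →
  Σ Label λ l → Σ (Fin (pairs (suc (double s)))) λ u → port (suc (double s)) l u ≡ k
port-or-last s k k≢last = port-surjective _ k (subst (λ z → toℕ k < double z) (sym (pairs-odd s)) k<)
  where
  k< : toℕ k < double s
  k< = ℕP.≤∧≢⇒< (s≤s⁻¹ (FinP.toℕ<n k))
         (λ e → k≢last (FinP.toℕ-injective (trans e (sym (FinP.toℕ-fromℕ (double s))))))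

Disjoint : ∀ {m} → Comparator m → Comparator m → Set
Disjoint c d = ∀ k → Uses c k → ¬ Uses d k

-- A presented network: comparators (the second layer) together with a family
-- of labelled "ports" (the outputs of the first layer), each sitting on a channel.
record Presentation (m : ℕ) : Set where
  constructor presentation
  field
    nPorts : ℕ
    portCh : Label → Fin nPorts → Fin m
    nComps : ℕ
    compAt : Fin nComps → Comparator m
open Presentation public

Incident : ∀ {m} (X : Presentation m) → Label → Fin (nPorts X) → Fin (nComps X) → Set
Incident X l u v = Uses (compAt X v) (portCh X l u)

record _≅_ {m m'} (X : Presentation m) (Y : Presentation m') : Set where
  constructor iso
  field
    onPorts : Permutation (nPorts X) (nPorts Y)
    onComps : Permutation (nComps X) (nComps Y)
    preserves : ∀ l u v → Incident X l u v ⇔ Incident Y l (onPorts ⟨$⟩ʳ u) (onComps ⟨$⟩ʳ v)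
open _≅_ public

≅-refl : ∀ {m} {X : Presentation m} → X ≅ X
≅-refl = iso Perm.id Perm.id λ _ _ _ → ⇔.refl

≅-sym : ∀ {m m'} {X : Presentation m} {Y : Presentation m'} → X ≅ Y → Y ≅ X
≅-sym {Y = Y} (iso α β E) = iso (Perm.flip α) (Perm.flip β) λ l u v →
  ⇔.sym (⇔.trans (E l (α ⟨$⟩ˡ u) (β ⟨$⟩ˡ v))
                 (mk⇔ (subst₂ (Incident Y l) (inverseʳ α) (inverseʳ β))
                      (subst₂ (Incident Y l) (sym (inverseʳ α)) (sym (inverseʳ β)))))

≅-trans : ∀ {m m' m''} {X : Presentation m} {Y : Presentation m'} {Z : Presentation m''} →
  X ≅ Y → Y ≅ Z → X ≅ Z
≅-trans (iso α β E) (iso α' β' E') =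
  iso (α ∘ₚ α') (β ∘ₚ β') λ l u v → ⇔.trans (E l u v) (E' l (α ⟨$⟩ʳ u) (β ⟨$⟩ʳ v))

≅-via : ∀ {m m'} {X : Presentation m} {Y : Presentation m'} (e : Fin m → Fin m')
  (α : Permutation (nPorts X) (nPorts Y)) (β : Permutation (nComps X) (nComps Y)) →
  (∀ l u → portCh Y l (α ⟨$⟩ʳ u) ≡ e (portCh X l u)) →
  (∀ v k → Uses (compAt X v) k ⇔ Uses (compAt Y (β ⟨$⟩ʳ v)) (e k)) → X ≅ Y
≅-via {X = X} {Y} e α β onPorts uses = iso α β λ l u v →
  ⇔.trans (uses v (portCh X l u))
          (mk⇔ (subst (Uses (compAt Y (β ⟨$⟩ʳ v))) (sym (onPorts l u)))
               (subst (Uses (compAt Y (β ⟨$⟩ʳ v))) (onPorts l u)))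

record Layer (m : ℕ) : Set where
  constructor layer
  field
    size : ℕ
    gate : Fin size → Comparator m
    disjoint : ∀ i j → i ≢ j → Disjoint (gate i) (gate j)
open Layer public

-- The graph of F_m ; X, presented with the comparators of F_m as ports.
present : ∀ {m} → Layer m → Presentation m
present {m} X = presentation (pairs m) (port m) (size X) (gate X)

_≃_ : ∀ {m m'} → Layer m → Layer m' → Set
X ≃ Y = present X ≅ present Y

≡⇒⇔ : ∀ {A B : Set} → A ≡ B → A ⇔ B
≡⇒⇔ refl = ⇔.refl

Disjoint-sym : ∀ {m} (c d : Comparator m) → Disjoint c d → Disjoint d c
Disjoint-sym c d c#d k uses-d uses-c = c#d k uses-c uses-d

allPairs-lookup< : ∀ {A : Set} {R : A → A → Set} {xs : List A} → AllPairs R xs →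
  ∀ {i j} → toℕ i < toℕ j → R (lookup xs i) (lookup xs j)
allPairs-lookup< (R-later ∷ _) {zero} {suc j} _ = All.lookup R-later (∈-lookup j)
allPairs-lookup< (_ ∷ rest) {suc i} {suc j} (s≤s i<j) = allPairs-lookup< rest i<j

allPairs-lookup : ∀ {A : Set} {R : A → A → Set} → (∀ {x y} → R x y → R y x) →
  ∀ {xs : List A} → AllPairs R xs → ∀ i j → i ≢ j → R (lookup xs i) (lookup xs j)
allPairs-lookup R-sym allR i j i≢j with ℕP.<-cmp (toℕ i) (toℕ j)
... | tri< i<j _ _ = allPairs-lookup< allR i<j
... | tri≈ _ i≡j _ = ⊥-elim (i≢j (FinP.toℕ-injective i≡j))
... | tri> _ _ j<i = R-sym (allPairs-lookup< allR j<i)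

uses-shift2 : ∀ {m} (c : Comparator m) {k} → Uses (shift2 c) (suc (suc k)) → Uses c k
uses-shift2 (comp i j p) (inj₁ e) = inj₁ (FinP.suc-injective (FinP.suc-injective e))
uses-shift2 (comp i j p) (inj₂ e) = inj₂ (FinP.suc-injective (FinP.suc-injective e))

shift2-disjoint : ∀ {m} (c d : Comparator m) → Disjoint c d → Disjoint (shift2 c) (shift2 d)
shift2-disjoint (comp i j p) d c#d _ (inj₁ refl) uses-d = c#d i (inj₁ refl) (uses-shift2 d uses-d)
shift2-disjoint (comp i j p) d c#d _ (inj₂ refl) uses-d = c#d j (inj₂ refl) (uses-shift2 d uses-d)

first-disjoint-shift2 : ∀ {m} (d : Comparator m) → Disjoint first (shift2 d)
first-disjoint-shift2 (comp i j p) _ (inj₁ refl) (inj₁ ())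
first-disjoint-shift2 (comp i j p) _ (inj₁ refl) (inj₂ ())
first-disjoint-shift2 (comp i j p) _ (inj₂ refl) (inj₁ ())
first-disjoint-shift2 (comp i j p) _ (inj₂ refl) (inj₂ ())

valid-Fm : ∀ m → ValidLayer (Fm m)
valid-Fm zero = []
valid-Fm (suc zero) = []
valid-Fm (suc (suc m)) =
  AllP.map⁺ (All.universal first-disjoint-shift2 (Fm m)) ∷
  AllPairsP.map⁺ (AllPairs.map (λ {c} {d} → shift2-disjoint c d) (valid-Fm m))

secondLayer : ∀ {m} → NetF m → Layer m
secondLayer (C , _) = layer (length (L2 C)) (lookup (L2 C))
  (allPairs-lookup (λ {c} {d} → Disjoint-sym c d) (valid2 C))

withFirstLayer : ∀ {m} → Layer m → NetF m
withFirstLayer {m} X = record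
  { L1 = Fm m ; L2 = tabulate (gate X) ; valid1 = valid-Fm m
  ; valid2 = AllPairsP.tabulate⁺ (disjoint X _ _) } , refl

secondLayer-withFirstLayer : ∀ {m} (X : Layer m) → X ≃ secondLayer (withFirstLayer X)
secondLayer-withFirstLayer X =
  ≅-via id Perm.id (Perm.cast-id (sym (ListP.length-tabulate (gate X)))) (λ _ _ → refl)
    λ v k → ≡⇒⇔ (cong (λ c → Uses c k) (sym (ListP.lookup-tabulate (gate X) v)))

edge≡incident : ∀ {m} (C : TwoLayer m) (L1≡Fm : L1 C ≡ Fm m) u v l →
  Edge C (inj₁ u) (inj₂ v) l ≡ Incident (present (secondLayer (C , L1≡Fm))) l (subst (Fin ∘ length) L1≡Fm u) v
edge≡incident C refl u v one = refl
edge≡incident C refl u v two = refl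

≃⇒≈ : ∀ {m} (C D : NetF m) → secondLayer C ≃ secondLayer D → proj₁ C ≈ proj₁ D
≃⇒≈ (C , refl) (D , refl) (iso α β E) = (α ⊎-↔ β) , edges
  where
  edges : ∀ x y l → Edge C x y l ⇔ Edge D (Inverse.to (α ⊎-↔ β) x) (Inverse.to (α ⊎-↔ β) y) l
  edges (inj₁ u) (inj₂ v) l = ⇔.trans (≡⇒⇔ (edge≡incident C refl u v l))
    (⇔.trans (E l u v) (≡⇒⇔ (sym (edge≡incident D refl (α ⟨$⟩ʳ u) (β ⟨$⟩ʳ v) l))))
  edges (inj₁ u) (inj₁ v) l = mk⇔ (λ ()) (λ ())
  edges (inj₂ u) (inj₁ v) l = mk⇔ (λ ()) (λ ())
  edges (inj₂ u) (inj₂ v) l = mk⇔ (λ ()) (λ ())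

IsInj₂ : ∀ {A B : Set} → A ⊎ B → Set
IsInj₂ (inj₁ _) = ⊥
IsInj₂ (inj₂ _) = ⊤

keeps-inj₁ : ∀ {A B A' B' : Set} (h : A ⊎ B → A' ⊎ B') → (∀ x → IsInj₂ x ⇔ IsInj₂ (h x)) →
  ∀ a → Σ A' λ a' → h (inj₁ a) ≡ inj₁ a'
keeps-inj₁ h sides a with h (inj₁ a) | sides (inj₁ a)
... | inj₁ a' | _ = a' , refl
... | inj₂ _ | s = ⊥-elim (⇐ s tt)

keeps-inj₂ : ∀ {A B A' B' : Set} (h : A ⊎ B → A' ⊎ B') → (∀ x → IsInj₂ x ⇔ IsInj₂ (h x)) →
  ∀ b → Σ B' λ b' → h (inj₂ b) ≡ inj₂ b'
keeps-inj₂ h sides b with h (inj₂ b) | sides (inj₂ b)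
... | inj₂ b' | _ = b' , refl
... | inj₁ _ | s = ⊥-elim (⇒ s tt)

restriction-inverse : ∀ {S S' P P' : Set} {ι : P → S} {ι' : P' → S'} →
  (∀ {x y} → ι' x ≡ ι' y → x ≡ y) → (h : S → S') (k : S' → S) → (∀ y → h (k y) ≡ y) →
  (r : P → P') (s : P' → P) → (∀ p → h (ι p) ≡ ι' (r p)) → (∀ p' → k (ι' p') ≡ ι (s p')) →
  ∀ p' → r (s p') ≡ p'
restriction-inverse {ι = ι} {ι'} ι'-injective h k hk r s hr ks p' = ι'-injective (begin
  ι' (r (s p'))  ≡⟨ sym (hr (s p')) ⟩
  h (ι (s p'))   ≡⟨ cong h (sym (ks p')) ⟩
  h (k (ι' p'))  ≡⟨ hk (ι' p') ⟩
  ι' p'          ∎)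
  where open ≡-Reasoning

restrict-⊎-↔ : ∀ {A B A' B' : Set} (f : (A ⊎ B) ↔ (A' ⊎ B')) →
  (∀ x → IsInj₂ x ⇔ IsInj₂ (Inverse.to f x)) →
  Σ (A ↔ A') λ g → Σ (B ↔ B') λ h →
    (∀ a → Inverse.to f (inj₁ a) ≡ inj₁ (Inverse.to g a)) × (∀ b → Inverse.to f (inj₂ b) ≡ inj₂ (Inverse.to h b))
restrict-⊎-↔ f sides =
  mk↔ₛ′ (proj₁ ∘ F₁) (proj₁ ∘ G₁)
    (restriction-inverse inj₁-injective F G FG _ _ (proj₂ ∘ F₁) (proj₂ ∘ G₁))
    (restriction-inverse inj₁-injective G F GF _ _ (proj₂ ∘ G₁) (proj₂ ∘ F₁)) ,
  mk↔ₛ′ (proj₁ ∘ F₂) (proj₁ ∘ G₂)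
    (restriction-inverse inj₂-injective F G FG _ _ (proj₂ ∘ F₂) (proj₂ ∘ G₂))
    (restriction-inverse inj₂-injective G F GF _ _ (proj₂ ∘ G₂) (proj₂ ∘ F₂)) ,
  proj₂ ∘ F₁ , proj₂ ∘ F₂
  where
  F = Inverse.to f
  G = Inverse.from f
  FG = Inverse.strictlyInverseˡ f
  GF = Inverse.strictlyInverseʳ f
  sides⁻¹ : ∀ y → IsInj₂ y ⇔ IsInj₂ (G y)
  sides⁻¹ y = ⇔.sym (⇔.trans (sides (G y)) (≡⇒⇔ (cong IsInj₂ (FG y))))
  F₁ = keeps-inj₁ F sides
  F₂ = keeps-inj₂ F sides
  G₁ = keeps-inj₁ G sides⁻¹
  G₂ = keeps-inj₂ G sides⁻¹

HasInEdge : ∀ {m} (C : TwoLayer m) → Vertex C → Set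
HasInEdge C x = Σ (Vertex C) λ y → Σ Label λ l → Edge C y x l

-- With first layer F_m the vertices with an incoming edge are exactly the
-- second-layer comparators, since the smaller channel of a comparator is a port.
inEdge⇔inj₂ : ∀ {m} (C : TwoLayer m) (L1≡Fm : L1 C ≡ Fm m) x → HasInEdge C x ⇔ IsInj₂ x
inEdge⇔inj₂ C refl (inj₁ u) = mk⇔ (λ { (inj₁ _ , _ , ()) ; (inj₂ _ , _ , ()) }) (λ ())
inEdge⇔inj₂ C refl (inj₂ v) = mk⇔ (λ _ → tt) λ _ →
  let (l , u , port≡lo) = lo-port (lookup (L2 C) v)
  in inj₁ u , l , subst id (sym (edge≡incident C refl u v l)) (inj₁ (sym port≡lo))

inEdge-transport : ∀ {m} {C D : TwoLayer m} (C≈D : C ≈ D) x →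
  HasInEdge C x ⇔ HasInEdge D (Inverse.to (proj₁ C≈D) x)
inEdge-transport {D = D} (f , E) x = mk⇔
  (λ { (y , l , e) → Inverse.to f y , l , ⇒ (E y x l) e })
  (λ { (y , l , e) → Inverse.from f y , l ,
         ⇐ (E (Inverse.from f y) x l) (subst (λ z → Edge D z _ l) (sym (Inverse.strictlyInverseˡ f y)) e) })

-- ... and conversely, since a graph isomorphism maps first-layer vertices (those
-- without incoming edges) to first-layer vertices.
≈⇒≃ : ∀ {m} (C D : NetF m) → proj₁ C ≈ proj₁ D → secondLayer C ≃ secondLayer D
≈⇒≃ (C , refl) (D , refl) (f , E) with restrict-⊎-↔ f sides
  where
  sides : ∀ x → IsInj₂ x ⇔ IsInj₂ (Inverse.to f x)
  sides x = ⇔.trans (⇔.sym (inEdge⇔inj₂ C refl x))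
              (⇔.trans (inEdge-transport (f , E) x) (inEdge⇔inj₂ D refl (Inverse.to f x)))
... | α , β , onPorts , onComps = iso α β λ l u v →
  ⇔.trans (≡⇒⇔ (sym (edge≡incident C refl u v l)))
  (⇔.trans (E (inj₁ u) (inj₂ v) l)
  (⇔.trans (≡⇒⇔ (cong₂ (λ x y → Edge D x y l) (onPorts u) (onComps v)))
           (≡⇒⇔ (edge≡incident D refl (α ⟨$⟩ʳ u) (β ⟨$⟩ʳ v) l))))

record Classes (m : ℕ) (I : Set) : Set where
  constructor classes
  field
    rep : I → Layer m
    rep-distinct : ∀ i j → rep i ≃ rep j → i ≡ j
    rep-cover : ∀ (X : Layer m) → Σ I λ i → X ≃ rep i
open Classes public

classCount⇒classes : ∀ {m k} → ClassCount m k → Classes m (Fin k)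
classCount⇒classes (r , distinct , cover) = classes (λ i → secondLayer (r i))
  (λ i j i≃j → distinct i j (≃⇒≈ (r i) (r j) i≃j))
  λ X → let (i , X≈rᵢ) = cover (withFirstLayer X) in
    i , ≅-trans (secondLayer-withFirstLayer X) (≈⇒≃ (withFirstLayer X) (r i) X≈rᵢ)

classes⇒classCount : ∀ {m k} → Classes m (Fin k) → ClassCount m k
classes⇒classCount (classes r distinct cover) = (λ i → withFirstLayer (r i)) ,
  (λ i j i≈j → distinct i j
     (≅-trans (secondLayer-withFirstLayer (r i))
     (≅-trans (≈⇒≃ (withFirstLayer (r i)) (withFirstLayer (r j)) i≈j)
              (≅-sym (secondLayer-withFirstLayer (r j)))))) ,
  λ C → let (i , C≃rᵢ) = cover (secondLayer C) in
    i , ≃⇒≈ C (withFirstLayer (r i)) (≅-trans C≃rᵢ (secondLayer-withFirstLayer (r i)))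

classes-reindex : ∀ {m I J} → I ↔ J → Classes m I → Classes m J
classes-reindex f (classes r distinct cover) = classes (λ j → r (Inverse.from f j))
  (λ i j i≃j → begin
     i                                 ≡⟨ sym (Inverse.strictlyInverseˡ f i) ⟩
     Inverse.to f (Inverse.from f i)   ≡⟨ cong (Inverse.to f) (distinct _ _ i≃j) ⟩
     Inverse.to f (Inverse.from f j)   ≡⟨ Inverse.strictlyInverseˡ f j ⟩
     j                                 ∎)
  λ X → let (i , X≃rᵢ) = cover X in
    Inverse.to f i , subst (λ z → X ≃ r z) (sym (Inverse.strictlyInverseʳ f i)) X≃rᵢ
  where open ≡-Reasoning

-- Any two systems of representatives give injections both ways, so they have the same size.
classes-≤ : ∀ {m a b} → Classes m (Fin a) → Classes m (Fin b) → a ≤ b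
classes-≤ A B = FinP.injective⇒≤ {f = λ i → proj₁ (rep-cover B (rep A i))} λ {i} {j} same →
  rep-distinct A i j (≅-trans (proj₂ (rep-cover B (rep A i)))
    (≅-sym (subst (λ z → rep A j ≃ rep B z) (sym same) (proj₂ (rep-cover B (rep A j))))))

classes-unique : ∀ {m a b} → Classes m (Fin a) → Classes m (Fin b) → a ≡ b
classes-unique A B = ℕP.≤-antisym (classes-≤ A B) (classes-≤ B A)

Extensional : ∀ {a b} → (Permutation a b → Set) → Set
Extensional P = ∀ π ρ → π Perm.≈ ρ → P π → P ρ

insert-zero-cong : ∀ {a b} (j : Fin (suc b)) {π ρ : Permutation a b} → π Perm.≈ ρ →
  insert zero j π Perm.≈ insert zero j ρ
insert-zero-cong j π≈ρ zero = refl
insert-zero-cong j {π} {ρ} π≈ρ (suc k) = begin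
  insert zero j π ⟨$⟩ʳ suc k  ≡⟨ insert-punchIn zero j π k ⟩
  punchIn j (π ⟨$⟩ʳ k)        ≡⟨ cong (punchIn j) (π≈ρ k) ⟩
  punchIn j (ρ ⟨$⟩ʳ k)        ≡⟨ sym (insert-punchIn zero j ρ k) ⟩
  insert zero j ρ ⟨$⟩ʳ suc k  ∎
  where open ≡-Reasoning

-- Whether some permutation has a decidable extensional property is decidable:
-- a permutation of 1 + a points is determined by the image j of 0 and the
-- remaining permutation ρ, being (extensionally) insert 0 j ρ.
any-permutation? : ∀ a b (P : Permutation a b → Set) → Extensional P → (∀ π → Dec (P π)) →
  Dec (Σ (Permutation a b) P)
any-permutation? zero zero P ext P? = map′ (Perm.id ,_) (λ (π , p) → ext π Perm.id (λ ()) p) (P? Perm.id)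
any-permutation? zero (suc b) P ext P? = no λ (π , _) → ℕP.0≢1+n (↔⇒≡ π)
any-permutation? (suc a) zero P ext P? = no λ (π , _) → ℕP.1+n≢0 (↔⇒≡ π)
any-permutation? (suc a) (suc b) P ext P? = map′
  (λ (j , ρ , p) → insert zero j ρ , p)
  (λ (π , p) → π ⟨$⟩ʳ zero , remove zero π , ext π _ (λ i → sym (insert-remove zero π i)) p)
  (FinP.any? λ j → any-permutation? a b (λ ρ → P (insert zero j ρ))
                     (λ π ρ π≈ρ → ext _ _ (insert-zero-cong j π≈ρ)) (λ ρ → P? (insert zero j ρ)))

_⇔?_ : ∀ {A B : Set} → Dec A → Dec B → Dec (A ⇔ B)
A? ⇔? B? = map′ (uncurry mk⇔) (λ A⇔B → ⇒ A⇔B , ⇐ A⇔B) ((A? →-dec B?) ×-dec (B? →-dec A?))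

all-labels? : ∀ {P : Label → Set} → (∀ l → Dec (P l)) → Dec (∀ l → P l)
all-labels? {P} P? = map′ (λ (p₁ , p₂) → λ { one → p₁ ; two → p₂ }) (λ p → p one , p two) (P? one ×-dec P? two)

uses? : ∀ {m} (c : Comparator m) k → Dec (Uses c k)
uses? c k = (lo c FinP.≟ k) ⊎-dec (hi c FinP.≟ k)

≅? : ∀ {m m'} (X : Presentation m) (Y : Presentation m') → Dec (X ≅ Y)
≅? X Y = map′ (λ (α , β , E) → iso α β E) (λ (iso α β E) → α , β , E)
  (any-permutation? (nPorts X) (nPorts Y) (λ α → Σ _ (Preserves α)) ext-α λ α →
     any-permutation? (nComps X) (nComps Y) (Preserves α) (ext-β α) (preserves? α))
  where
  Preserves : Permutation (nPorts X) (nPorts Y) → Permutation (nComps X) (nComps Y) → Set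
  Preserves α β = ∀ l u v → Incident X l u v ⇔ Incident Y l (α ⟨$⟩ʳ u) (β ⟨$⟩ʳ v)
  preserves? : ∀ α β → Dec (Preserves α β)
  preserves? α β = all-labels? λ l → FinP.all? λ u → FinP.all? λ v →
    uses? (compAt X v) (portCh X l u) ⇔? uses? (compAt Y (β ⟨$⟩ʳ v)) (portCh Y l (α ⟨$⟩ʳ u))
  ext-β : ∀ α → Extensional (Preserves α)
  ext-β α β β' β≈β' E l u v = ⇔.trans (E l u v) (≡⇒⇔ (cong (Incident Y l (α ⟨$⟩ʳ u)) (β≈β' v)))
  ext-α : Extensional (λ α → Σ _ (Preserves α))
  ext-α α α' α≈α' (β , E) = β , λ l u v → ⇔.trans (E l u v) (≡⇒⇔ (cong (λ w → Incident Y l w (β ⟨$⟩ʳ v)) (α≈α' u)))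

-- If a decidable equivalence has a finite list meeting every class, its classes
-- can be counted: deduplicating the list gives a system of distinct representatives.
module _ (S : DecSetoid 0ℓ 0ℓ) where
  open DecSetoid S using (Carrier; _≟_) renaming (_≈_ to _∼_; sym to ∼-sym; trans to ∼-trans)

  count-classes : (xs : List Carrier) → (∀ x → Any (x ∼_) xs) →
    Σ ℕ λ k → Σ (Fin k → Carrier) λ r → (∀ i j → r i ∼ r j → i ≡ j) × (∀ x → Σ (Fin k) λ i → x ∼ r i)
  count-classes xs meets = length reps , lookup reps , distinct , cover
    where
    reps = deduplicate _≟_ xs
    distinct : ∀ i j → lookup reps i ∼ lookup reps j → i ≡ j
    distinct i j rᵢ∼rⱼ with i FinP.≟ j
    ... | yes i≡j = i≡j
    ... | no i≢j = ⊥-elim (allPairs-lookup (λ x≉y y∼x → x≉y (∼-sym y∼x)) (UniqueP.deduplicate-! S xs) i j i≢j rᵢ∼rⱼ)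
    cover : ∀ x → Σ (Fin (length reps)) λ i → x ∼ lookup reps i
    cover x = Any.index x∈reps , AnyP.lookup-index x∈reps
      where x∈reps = AnyP.deduplicate⁺ _≟_ (λ y∼z x∼z → ∼-trans x∼z (∼-sym y∼z)) (meets x)

comparatorsOn : ∀ {m} → Fin m → Fin m → List (Comparator m)
comparatorsOn i j with i FinP.<? j
... | yes i<j = comp i j i<j ∷ []
... | no _ = []

∈-comparatorsOn : ∀ {m} (c : Comparator m) → c ∈ comparatorsOn (lo c) (hi c)
∈-comparatorsOn (comp i j i<j) with i FinP.<? j
... | yes i<j' = here (cong (comp i j) (FinP.<-irrelevant i<j i<j'))
... | no i≮j = ⊥-elim (i≮j i<j)

allComparators : ∀ m → List (Comparator m)
allComparators m = concat (cartesianProductWith comparatorsOn (allFin m) (allFin m))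

∈-allComparators : ∀ {m} (c : Comparator m) → c ∈ allComparators m
∈-allComparators {m} c = AnyP.concat⁺ (AnyP.cartesianProductWith⁺ comparatorsOn
  (λ { refl refl → ∈-comparatorsOn c }) (∈-allFin (lo c)) (∈-allFin (hi c)))

allFunctions : ∀ {A : Set} N → List A → List (Fin N → A)
allFunctions zero xs = (λ ()) ∷ []
allFunctions (suc N) xs = cartesianProductWith Vector._∷_ xs (allFunctions N xs)

allFunctions-complete : ∀ {A : Set} {xs : List A} N (f : Fin N → A) → (∀ i → f i ∈ xs) →
  Any (λ g → ∀ i → f i ≡ g i) (allFunctions N xs)
allFunctions-complete zero f _ = here (λ ())
allFunctions-complete (suc N) f f∈ = AnyP.cartesianProductWith⁺ Vector._∷_
  (λ { refl f≗g → λ { zero → refl ; (suc i) → f≗g i } })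
  (f∈ zero) (allFunctions-complete N (λ i → f (suc i)) (λ i → f∈ (suc i)))

disjoint? : ∀ {m} (c d : Comparator m) → Dec (Disjoint c d)
disjoint? c d = FinP.all? λ k → uses? c k →-dec ¬? (uses? d k)

gates-disjoint? : ∀ {m N} (g : Fin N → Comparator m) → Dec (∀ i j → i ≢ j → Disjoint (g i) (g j))
gates-disjoint? g = FinP.all? λ i → FinP.all? λ j → ¬? (i FinP.≟ j) →-dec disjoint? (g i) (g j)

asLayer : ∀ {m} N → (Fin N → Comparator m) → List (Layer m)
asLayer N g with gates-disjoint? g
... | yes g-disjoint = layer N g g-disjoint ∷ []
... | no _ = []

layersOfSize : ∀ m N → List (Layer m)
layersOfSize m N = concatMap (asLayer N) (allFunctions N (allComparators m))

candidates : ∀ m → List (Layer m)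
candidates m = concatMap (layersOfSize m) (upTo (suc m))

-- A second layer has at most m comparators, as their smaller channels differ.
size≤ : ∀ {m} (X : Layer m) → size X ≤ m
size≤ X = FinP.injective⇒≤ {f = λ v → lo (gate X v)} same-lo⇒same
  where
  same-lo⇒same : ∀ {i j} → lo (gate X i) ≡ lo (gate X j) → i ≡ j
  same-lo⇒same {i} {j} same-lo with i FinP.≟ j
  ... | yes i≡j = i≡j
  ... | no i≢j = ⊥-elim (disjoint X i j i≢j _ (inj₁ refl) (inj₁ (sym same-lo)))

candidates-complete : ∀ {m} (X : Layer m) → Any (X ≃_) (candidates m)
candidates-complete {m} X = AnyP.concatMap⁺ (layersOfSize m) (AnyP.applyUpTo⁺ id
  (AnyP.concatMap⁺ (asLayer (size X))
     (Any.map in-asLayer (allFunctions-complete (size X) (gate X) (λ i → ∈-allComparators (gate X i)))))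
  (s≤s (size≤ X)))
  where
  in-asLayer : ∀ {g} → (∀ i → gate X i ≡ g i) → Any (X ≃_) (asLayer (size X) g)
  in-asLayer {g} X≗g with gates-disjoint? g
  ... | yes g-disjoint = here (≅-via id Perm.id Perm.id (λ _ _ → refl) λ v k → ≡⇒⇔ (cong (λ c → Uses c k) (X≗g v)))
  ... | no g-overlap = ⊥-elim (g-overlap λ i j i≢j → subst₂ Disjoint (X≗g i) (X≗g j) (disjoint X i j i≢j))

layers : ℕ → DecSetoid 0ℓ 0ℓ
layers m = record
  { Carrier = Layer m ; _≈_ = _≃_
  ; isDecEquivalence = record
    { isEquivalence = record { refl = ≅-refl ; sym = ≅-sym ; trans = ≅-trans }
    ; _≟_ = λ X Y → ≅? (present X) (present Y) } }

classes-exist : ∀ m → Σ ℕ λ k → Classes m (Fin k)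
classes-exist m with count-classes (layers m) (candidates m) candidates-complete
... | k , r , distinct , cover = k , classes r distinct cover

sorted : ∀ {m} (a b : Fin m) → a ≢ b → Comparator m
sorted a b a≢b with FinP.<-cmp a b
... | tri< a<b _ _ = comp a b a<b
... | tri≈ _ a≡b _ = ⊥-elim (a≢b a≡b)
... | tri> _ _ b<a = comp b a b<a

uses-sorted : ∀ {m} (a b : Fin m) (a≢b : a ≢ b) k → Uses (sorted a b a≢b) k ⇔ ((a ≡ k) ⊎ (b ≡ k))
uses-sorted a b a≢b k with FinP.<-cmp a b
... | tri< _ _ _ = ⇔.refl
... | tri≈ _ a≡b _ = ⊥-elim (a≢b a≡b)
... | tri> _ _ _ = mk⇔ Sum.swap Sum.swap

relabel : ∀ {m m'} (e : Fin m → Fin m') (c : Comparator m) → e (lo c) ≢ e (hi c) → Comparator m'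
relabel e c apart = sorted (e (lo c)) (e (hi c)) apart

uses-relabel : ∀ {m m'} (e : Fin m → Fin m') c apart k →
  Uses (relabel e c apart) k ⇔ ((e (lo c) ≡ k) ⊎ (e (hi c) ≡ k))
uses-relabel e c apart = uses-sorted (e (lo c)) (e (hi c)) apart

uses-relabel-at : ∀ {m m'} (e : Fin m → Fin m') c apart {k k*} →
  ((e (lo c) ≡ k) ⇔ (lo c ≡ k*)) → ((e (hi c) ≡ k) ⇔ (hi c ≡ k*)) → Uses (relabel e c apart) k ⇔ Uses c k*
uses-relabel-at e c apart lo-spec hi-spec = ⇔.trans (uses-relabel e c apart _) (lo-spec ⊎-⇔ hi-spec)

relabel-image : ∀ {m m'} (e : Fin m → Fin m') c apart {k} →
  Uses (relabel e c apart) k → Σ (Fin m) λ x → (e x ≡ k) × Uses c x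
relabel-image e c apart used with ⇒ (uses-relabel e c apart _) used
... | inj₁ e-lo = lo c , e-lo , inj₁ refl
... | inj₂ e-hi = hi c , e-hi , inj₂ refl

injective-apart : ∀ {m m'} {e : Fin m → Fin m'} → Injective _≡_ _≡_ e → ∀ c → e (lo c) ≢ e (hi c)
injective-apart e-inj c same = FinP.<⇒≢ (lo<hi c) (e-inj same)

embed : ∀ {m m'} (e : Fin m → Fin m') → Injective _≡_ _≡_ e → Comparator m → Comparator m'
embed e e-inj c = relabel e c (injective-apart e-inj c)

uses-embed : ∀ {m m'} (e : Fin m → Fin m') (e-inj : Injective _≡_ _≡_ e) c k →
  Uses (embed e e-inj c) (e k) ⇔ Uses c k
uses-embed e e-inj c k =
  ⇔.trans (uses-relabel e c _ (e k)) (mk⇔ (Sum.map e-inj e-inj) (Sum.map (cong e) (cong e)))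

mapLayer : ∀ {m m'} (e : Fin m → Fin m') → Injective _≡_ _≡_ e → Layer m → Layer m'
mapLayer e e-inj X = layer (size X) (λ v → embed e e-inj (gate X v))
  λ i j i≢j k used-i used-j →
    let (x , ex≡k , used-x) = relabel-image e (gate X i) _ used-i
    in disjoint X i j i≢j x used-x
         (⇒ (uses-embed e e-inj (gate X j) x) (subst (Uses (embed e e-inj (gate X j))) (sym ex≡k) used-j))

partner : ∀ {m} (c : Comparator m) {k} → Uses c k →
  Σ (Fin m) λ p → (p ≢ k) × (∀ k' → Uses c k' ⇔ ((k' ≡ k) ⊎ (k' ≡ p)))
partner c (inj₁ refl) = hi c , (λ hi≡lo → FinP.<⇒≢ (lo<hi c) (sym hi≡lo)) , λ k' →
  mk⇔ (Sum.map sym sym) (Sum.map sym sym)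
partner c (inj₂ refl) = lo c , FinP.<⇒≢ (lo<hi c) , λ k' →
  mk⇔ (Sum.swap ∘ Sum.map sym sym) (Sum.map sym sym ∘ Sum.swap)

SingleInput : ∀ {m} (X : Presentation m) → Fin (nComps X) → Set
SingleInput X v = ∀ l u l' u' → Incident X l u v → Incident X l' u' v → (l ≡ l') × (u ≡ u')

singleInput-transport : ∀ {m m'} {X : Presentation m} {Y : Presentation m'} (I : X ≅ Y) v →
  SingleInput X v → SingleInput Y (onComps I ⟨$⟩ʳ v)
singleInput-transport {X = X} {Y} (iso α β E) v single l u l' u' inc inc'
  with single l (α ⟨$⟩ˡ u) l' (α ⟨$⟩ˡ u') (pull inc) (pull inc')
  where
  pull : ∀ {l u} → Incident Y l u (β ⟨$⟩ʳ v) → Incident X l (α ⟨$⟩ˡ u) v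
  pull {l} {u} inc = ⇐ (E l (α ⟨$⟩ˡ u) v) (subst (λ w → Incident Y l w (β ⟨$⟩ʳ v)) (sym (inverseʳ α)) inc)
... | l≡l' , same = l≡l' , (begin
  u                       ≡⟨ sym (inverseʳ α) ⟩
  α ⟨$⟩ʳ (α ⟨$⟩ˡ u)        ≡⟨ cong (α ⟨$⟩ʳ_) same ⟩
  α ⟨$⟩ʳ (α ⟨$⟩ˡ u')       ≡⟨ inverseʳ α ⟩
  u'                      ∎)
  where open ≡-Reasoning

-- On an odd number of channels, a comparator uses the last channel iff it has a
-- single input: its other channel is then a port, whereas a comparator on two
-- ports has two different inputs.
usesLast⇔singleInput : ∀ s (X : Layer (suc (double s))) v →
  Uses (gate X v) (last s) ⇔ SingleInput (present X) v
usesLast⇔singleInput s X v = mk⇔ single usesLast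
  where
  c = gate X v
  single : Uses c (last s) → SingleInput (present X) v
  single uses-last l u l' u' inc inc' with partner c uses-last
  ... | p , _ , channels = port-injective _ (trans (onPartner {l} {u} inc) (sym (onPartner {l'} {u'} inc')))
    where
    onPartner : ∀ {l u} → Uses c (port (suc (double s)) l u) → port (suc (double s)) l u ≡ p
    onPartner {l} {u} inc with ⇒ (channels _) inc
    ... | inj₁ at-last = ⊥-elim (port≢last s l u at-last)
    ... | inj₂ at-p = at-p
  usesLast : SingleInput (present X) v → Uses c (last s)
  usesLast single with uses? c (last s)
  ... | yes uses-last = uses-last
  ... | no avoids-last
    with port-or-last s (lo c) (avoids-last ∘ inj₁) | port-or-last s (hi c) (avoids-last ∘ inj₂)
  ... | l , u , port≡lo | l' , u' , port≡hi with single l u l' u' (inj₁ (sym port≡lo)) (inj₂ (sym port≡hi))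
  ... | refl , refl = ⊥-elim (FinP.<⇒≢ (lo<hi c) (trans (sym port≡lo) port≡hi))

usesLast-transport : ∀ s {X Y : Layer (suc (double s))} (I : X ≃ Y) v →
  Uses (gate X v) (last s) → Uses (gate Y (onComps I ⟨$⟩ʳ v)) (last s)
usesLast-transport s {X} {Y} I v uses-last =
  ⇐ (usesLast⇔singleInput s Y _) (singleInput-transport I v (⇒ (usesLast⇔singleInput s X v) uses-last))

usesLast-preserved : ∀ s {X Y : Layer (suc (double s))} (I : X ≃ Y) v →
  Uses (gate X v) (last s) ⇔ Uses (gate Y (onComps I ⟨$⟩ʳ v)) (last s)
usesLast-preserved s {X} {Y} I v = mk⇔ (usesLast-transport s {X} {Y} I v) λ uses-last →
  subst (λ w → Uses (gate X w) (last s)) (Perm.inverseˡ (onComps I))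
    (usesLast-transport s {Y} {X} (≅-sym I) _ uses-last)

-- Adding an unused last channel to an even number of channels keeps F_m.
module _ {s : ℕ} where

  pairs-last : pairs (double s) ≡ pairs (suc (double s))
  pairs-last = trans (pairs-double s) (sym (pairs-odd s))

  inject₁-port : ∀ l u → port (suc (double s)) l (cast pairs-last u) ≡ inject₁ (port (double s) l u)
  inject₁-port l u = FinP.toℕ-injective (begin
    toℕ (port (suc (double s)) l (cast pairs-last u))  ≡⟨ toℕ-port _ l _ ⟩
    offset l + double (toℕ (cast pairs-last u))        ≡⟨ cong (λ z → offset l + double z) (FinP.toℕ-cast pairs-last u) ⟩
    offset l + double (toℕ u)                          ≡⟨ sym (toℕ-port _ l u) ⟩
    toℕ (port (double s) l u)                          ≡⟨ sym (FinP.toℕ-inject₁ _) ⟩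
    toℕ (inject₁ (port (double s) l u))                ∎)
    where open ≡-Reasoning

  lift : Layer (double s) → Layer (suc (double s))
  lift = mapLayer inject₁ FinP.inject₁-injective

  lift-≃ : ∀ X → X ≃ lift X
  lift-≃ X = ≅-via inject₁ (Perm.cast-id pairs-last) Perm.id inject₁-port
    λ v k → ⇔.sym (uses-embed inject₁ FinP.inject₁-injective (gate X v) k)

  lift-avoids-last : ∀ X v → ¬ Uses (gate (lift X) v) (last s)
  lift-avoids-last X v uses-last with relabel-image inject₁ (gate X v) _ uses-last
  ... | _ , at-last , _ = FinP.fromℕ≢inject₁ (sym at-last)

  private
    below-last : ∀ {k : Fin (suc (double s))} → k ≢ last s → double s ≢ toℕ k
    below-last k≢last e = k≢last (FinP.toℕ-injective (trans (sym e) (sym (FinP.toℕ-fromℕ (double s)))))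

    lowerComparator : (c : Comparator (suc (double s))) → ¬ Uses c (last s) → Comparator (double s)
    lowerComparator c avoids = comp (lower₁ (lo c) (below-last (avoids ∘ inj₁))) (lower₁ (hi c) (below-last (avoids ∘ inj₂)))
      (subst₂ _<_ (sym (FinP.toℕ-lower₁ _ _)) (sym (FinP.toℕ-lower₁ _ _)) (lo<hi c))

  lower : (Y : Layer (suc (double s))) → (∀ v → ¬ Uses (gate Y v) (last s)) → Layer (double s)
  lower Y avoids = layer (size Y) (λ v → lowerComparator (gate Y v) (avoids v))
    λ i j i≢j k used-i used-j → disjoint Y i j i≢j (inject₁ k) (restore i used-i) (restore j used-j)
    where
    restore : ∀ v {k} → Uses (lowerComparator (gate Y v) (avoids v)) k → Uses (gate Y v) (inject₁ k)
    restore v = Sum.map (λ e → trans (sym (FinP.inject₁-lower₁ _ _)) (cong inject₁ e))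
                        (λ e → trans (sym (FinP.inject₁-lower₁ _ _)) (cong inject₁ e))

  lower-≃ : ∀ Y avoids → Y ≃ lift (lower Y avoids)
  lower-≃ Y avoids = ≅-via id Perm.id Perm.id (λ _ _ → refl) λ v k →
    ⇔.sym (⇔.trans (uses-relabel inject₁ (lowerComparator (gate Y v) (avoids v)) _ k)
      (≡⇒⇔ (cong₂ (λ a b → (a ≡ k) ⊎ (b ≡ k)) (FinP.inject₁-lower₁ _ _) (FinP.inject₁-lower₁ _ _))))

flip : Label → Label
flip one = two
flip two = one

flip≢ : ∀ l → flip l ≢ l
flip≢ one ()
flip≢ two ()

other≡flip : ∀ {l l'} → l' ≢ l → l' ≡ flip l
other≡flip {one} {one} l'≢l = ⊥-elim (l'≢l refl)
other≡flip {one} {two} _ = refl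
other≡flip {two} {one} _ = refl
other≡flip {two} {two} l'≢l = ⊥-elim (l'≢l refl)

_≟ᴸ_ : (l l' : Label) → Dec (l ≡ l')
one ≟ᴸ one = yes refl
one ≟ᴸ two = no λ ()
two ≟ᴸ one = no λ ()
two ≟ᴸ two = yes refl

first-injective : ∀ {m l l'} → output {suc (suc m)} l first ≡ output l' first → l ≡ l'
first-injective {l = one} {one} _ = refl
first-injective {l = two} {two} _ = refl
first-injective {l = one} {two} ()
first-injective {l = two} {one} ()

first≢shifted : ∀ {m} l (k : Fin m) → output l first ≢ suc (suc k)
first≢shifted one k ()
first≢shifted two k ()

stackedPort≡port : ∀ m l x → stackedPort m l x ≡ port (suc (suc m)) l (cast (sym (pairs-suc-suc m)) x)
stackedPort≡port m l x =
  trans (cong (stackedPort m l) (sym (FinP.cast-involutive (pairs-suc-suc m) (sym (pairs-suc-suc m)) x)))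
        (sym (port-suc-suc m l (cast (sym (pairs-suc-suc m)) x)))

stackedPort-injective : ∀ m {l l' x x'} → stackedPort m l x ≡ stackedPort m l' x' → (l ≡ l') × (x ≡ x')
stackedPort-injective m {l} {l'} {x} {x'} e
  with port-injective (suc (suc m)) {l} {l'} {cast (sym eq) x} {cast (sym eq) x'}
         (trans (sym (stackedPort≡port m l x)) (trans e (stackedPort≡port m l' x')))
  where eq = pairs-suc-suc m
... | l≡l' , same = l≡l' , (begin
  x                                  ≡⟨ sym (FinP.cast-involutive eq (sym eq) x) ⟩
  cast eq (cast (sym eq) x)          ≡⟨ cong (cast eq) same ⟩
  cast eq (cast (sym eq) x')         ≡⟨ FinP.cast-involutive eq (sym eq) x' ⟩
  x'                                 ∎)
  where
  open ≡-Reasoning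
  eq = pairs-suc-suc m

-- The recurrence for n = 2t + 3 channels.  Second layers on n - 2 = 2t + 1
-- channels get attached to the first comparator of F_n.
module Attach (t : ℕ) where

  m' : ℕ
  m' = suc (double t)

  n : ℕ
  n = suc (suc m')

  -- F_n presented with its first comparator as port 0 and the shifted F_(n-2) after it.
  stacked : Layer n → Presentation n
  stacked X = presentation (suc (pairs m')) (stackedPort m') (size X) (gate X)

  present≅stacked : ∀ X → present X ≅ stacked X
  present≅stacked X = ≅-via id (Perm.cast-id (pairs-suc-suc m')) Perm.id
    (λ l u → sym (port-suc-suc m' l u)) (λ _ _ → ⇔.refl)

  stackedPort≢last : ∀ l x → stackedPort m' l x ≢ last (suc t)
  stackedPort≢last l x e = port≢last (suc t) l (cast (sym (pairs-suc-suc m')) x) (trans (sym (stackedPort≡port m' l x)) e)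

  classify : (k : Fin n) → (k ≡ last (suc t)) ⊎ (Σ Label λ l → Σ (Fin (suc (pairs m'))) λ x → stackedPort m' l x ≡ k)
  classify k with k FinP.≟ last (suc t)
  ... | yes k≡last = inj₁ k≡last
  ... | no k≢last with port-or-last (suc t) k k≢last
  ...   | l , u , port≡k = inj₂ (l , cast (pairs-suc-suc m') u , trans (sym (port-suc-suc m' l u)) port≡k)

  -- Channels of a second layer D on n - 2 channels inside the attached network:
  -- the last channel of D becomes output flip l of the new first comparator,
  -- every other channel moves up by two.
  merge : Label → Fin m' → Fin n
  merge l k with k FinP.≟ last t
  ... | yes _ = output (flip l) first
  ... | no _ = suc (suc k)

  merge-cases : ∀ l k → ((k ≡ last t) × (merge l k ≡ output (flip l) first)) ⊎ ((k ≢ last t) × (merge l k ≡ suc (suc k)))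
  merge-cases l k with k FinP.≟ last t
  ... | yes k≡last = inj₁ (k≡last , refl)
  ... | no k≢last = inj₂ (k≢last , refl)

  merge-last : ∀ l → merge l (last t) ≡ output (flip l) first
  merge-last l with merge-cases l (last t)
  ... | inj₁ (_ , e) = e
  ... | inj₂ (k≢last , _) = ⊥-elim (k≢last refl)

  merge-port : ∀ l l' y → merge l (port m' l' y) ≡ stackedPort m' l' (suc y)
  merge-port l l' y with merge-cases l (port m' l' y)
  ... | inj₁ (at-last , _) = ⊥-elim (port≢last t l' y at-last)
  ... | inj₂ (_ , e) = e

  merge-injective : ∀ l → Injective _≡_ _≡_ (merge l)
  merge-injective l {x} {y} e with merge-cases l x | merge-cases l y
  ... | inj₁ (x≡last , _) | inj₁ (y≡last , _) = trans x≡last (sym y≡last)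
  ... | inj₁ (_ , ex) | inj₂ (_ , ey) = ⊥-elim (first≢shifted (flip l) y (trans (sym ex) (trans e ey)))
  ... | inj₂ (_ , ex) | inj₁ (_ , ey) = ⊥-elim (first≢shifted (flip l) x (trans (sym ey) (trans (sym e) ex)))
  ... | inj₂ (_ , ex) | inj₂ (_ , ey) = FinP.suc-injective (FinP.suc-injective (trans (sym ex) (trans e ey)))

  merge≢last : ∀ l k → merge l k ≢ last (suc t)
  merge≢last l k e with merge-cases l k
  ... | inj₁ (_ , ek) = first≢shifted (flip l) (last t) (trans (sym ek) e)
  ... | inj₂ (k≢last , ek) = k≢last (FinP.suc-injective (FinP.suc-injective (trans (sym ek) e)))

  merge-onFirst : ∀ l k l' → merge l k ≡ output l' first → (k ≡ last t) × (l' ≡ flip l)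
  merge-onFirst l k l' e with merge-cases l k
  ... | inj₁ (k≡last , ek) = k≡last , first-injective (trans (sym e) ek)
  ... | inj₂ (_ , ek) = ⊥-elim (first≢shifted l' k (trans (sym e) ek))

  top : Label → Comparator n
  top l = sorted (output l first) (last (suc t)) (first≢shifted l (last t))

  uses-top : ∀ l k → Uses (top l) k ⇔ ((output l first ≡ k) ⊎ (last (suc t) ≡ k))
  uses-top l = uses-sorted (output l first) (last (suc t)) (first≢shifted l (last t))

  moved : Label → Comparator m' → Comparator n
  moved l = embed (merge l) (merge-injective l)

  top-disjoint : ∀ l c → Disjoint (top l) (moved l c)
  top-disjoint l c k uses-top-k uses-moved-k with relabel-image (merge l) c _ uses-moved-k | ⇒ (uses-top l k) uses-top-k
  ... | x , merged , _ | inj₁ at-first = flip≢ l (sym (proj₂ (merge-onFirst l x l (trans merged (sym at-first)))))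
  ... | x , merged , _ | inj₂ at-last = merge≢last l x (trans merged (sym at-last))

  attach : Label → Layer m' → Layer n
  attach l D = layer (suc (size D)) (top l Vector.∷ gate D') disjoint-gates
    where
    D' = mapLayer (merge l) (merge-injective l) D
    disjoint-gates : ∀ i j → i ≢ j → Disjoint ((top l Vector.∷ gate D') i) ((top l Vector.∷ gate D') j)
    disjoint-gates zero zero i≢j = ⊥-elim (i≢j refl)
    disjoint-gates zero (suc j) _ = top-disjoint l (gate D j)
    disjoint-gates (suc i) zero _ = Disjoint-sym (top l) (moved l (gate D i)) (top-disjoint l (gate D i))
    disjoint-gates (suc i) (suc j) i≢j = disjoint D' i j (i≢j ∘ cong suc)

  top-first : ∀ l l' → Uses (top l) (output l' first) ⇔ (l' ≡ l)
  top-first l l' = mk⇔ onFirst λ { refl → ⇐ (uses-top l _) (inj₁ refl) }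
    where
    onFirst : Uses (top l) (output l' first) → l' ≡ l
    onFirst uses with ⇒ (uses-top l _) uses
    ... | inj₁ e = sym (first-injective e)
    ... | inj₂ e = ⊥-elim (first≢shifted l' (last t) (sym e))

  top-shifted : ∀ l l' y → ¬ Uses (top l) (stackedPort m' l' (suc y))
  top-shifted l l' y uses with ⇒ (uses-top l _) uses
  ... | inj₁ e = first≢shifted l _ e
  ... | inj₂ e = stackedPort≢last l' (suc y) (sym e)

  moved-first : ∀ l l' c → Uses (moved l c) (output l' first) ⇔ ((l' ≡ flip l) × Uses c (last t))
  moved-first l l' c = mk⇔ onFirst fromLast
    where
    onFirst : Uses (moved l c) (output l' first) → (l' ≡ flip l) × Uses c (last t)
    onFirst uses with relabel-image (merge l) c _ uses
    ... | x , merged , uses-x with merge-onFirst l x l' merged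
    ...   | refl , l'≡flip = l'≡flip , uses-x
    fromLast : (l' ≡ flip l) × Uses c (last t) → Uses (moved l c) (output l' first)
    fromLast (refl , uses-last) =
      subst (Uses (moved l c)) (merge-last l) (⇐ (uses-embed (merge l) (merge-injective l) c _) uses-last)

  moved-shifted : ∀ l l' y c → Uses (moved l c) (stackedPort m' l' (suc y)) ⇔ Uses c (port m' l' y)
  moved-shifted l l' y c = ⇔.trans
    (≡⇒⇔ (cong (Uses (moved l c)) (sym (merge-port l l' y))))
    (uses-embed (merge l) (merge-injective l) c _)

  attach-resp : ∀ l {D D'} → D ≃ D' → attach l D ≃ attach l D'
  attach-resp l {D} {D'} D≃D'@(iso α β E) = ≅-trans (present≅stacked (attach l D))
    (≅-trans (iso (lift₀ α) (lift₀ β) incidences) (≅-sym (present≅stacked (attach l D'))))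
    where
    incidences : ∀ l' x j → Incident (stacked (attach l D)) l' x j ⇔
                            Incident (stacked (attach l D')) l' (lift₀ α ⟨$⟩ʳ x) (lift₀ β ⟨$⟩ʳ j)
    incidences l' zero zero = ⇔.refl
    incidences l' (suc y) zero = mk⇔ (⊥-elim ∘ top-shifted l l' y) (⊥-elim ∘ top-shifted l l' (α ⟨$⟩ʳ y))
    incidences l' zero (suc i) = ⇔.trans (moved-first l l' (gate D i))
      (⇔.trans (⇔.refl ×-⇔ usesLast-preserved t {D} {D'} D≃D' i) (⇔.sym (moved-first l l' (gate D' (β ⟨$⟩ʳ i)))))
    incidences l' (suc y) (suc i) = ⇔.trans (moved-shifted l l' y (gate D i))
      (⇔.trans (E l' y i) (⇔.sym (moved-shifted l l' (α ⟨$⟩ʳ y) (gate D' (β ⟨$⟩ʳ i)))))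

  only-top-usesLast : ∀ l D j → Uses (gate (attach l D) j) (last (suc t)) → j ≡ zero
  only-top-usesLast l D zero _ = refl
  only-top-usesLast l D (suc i) uses with relabel-image (merge l) (gate D i) _ uses
  ... | x , at-last , _ = ⊥-elim (merge≢last l x at-last)

  top-port-zero : ∀ l x → Uses (top l) (stackedPort m' l x) → x ≡ zero
  top-port-zero l zero _ = refl
  top-port-zero l (suc y) uses = ⊥-elim (top-shifted l l y uses)

  -- ... and reflects it: an isomorphism fixes the new comparator and its port,
  -- so it restricts to an isomorphism of the original second layers.
  attach-reflect : ∀ l {D D'} → attach l D ≃ attach l D' → D ≃ D'
  attach-reflect l {D} {D'} I = iso (remove zero α) (remove zero β) incidences
    where
    I' = ≅-trans (≅-sym (present≅stacked (attach l D))) (≅-trans I (present≅stacked (attach l D')))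
    α = onPorts I'
    β = onComps I'
    β-fixes-top : β ⟨$⟩ʳ zero ≡ zero
    β-fixes-top = only-top-usesLast l D' _ (⇒ (usesLast-preserved (suc t) {attach l D} {attach l D'} I zero) (⇐ (uses-top l _) (inj₂ refl)))
    α-fixes-port : α ⟨$⟩ʳ zero ≡ zero
    α-fixes-port = top-port-zero l _
      (subst (Incident (stacked (attach l D')) l (α ⟨$⟩ʳ zero)) β-fixes-top (⇒ (preserves I' l zero zero) (⇐ (top-first l l) refl)))
    incidences : ∀ l' y i → Uses (gate D i) (port m' l' y) ⇔
                            Uses (gate D' (remove zero β ⟨$⟩ʳ i)) (port m' l' (remove zero α ⟨$⟩ʳ y))
    incidences l' y i = ⇔.trans (⇔.sym (moved-shifted l l' y (gate D i)))
      (⇔.trans (preserves I' l' (suc y) (suc i))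
      (⇔.trans (≡⇒⇔ (cong₂ (Incident (stacked (attach l D')) l')
                        (sym (lift₀-remove α α-fixes-port (suc y))) (sym (lift₀-remove β β-fixes-top (suc i)))))
               (moved-shifted l l' (remove zero α ⟨$⟩ʳ y) (gate D' (remove zero β ⟨$⟩ʳ i)))))

  -- The invariant separating the three families: the comparator on the last
  -- channel meets output l of F_n.
  LastMeets : Label → Layer n → Set
  LastMeets l Y = Σ (Fin (size Y)) λ v → Σ (Fin (pairs n)) λ u →
    Uses (gate Y v) (last (suc t)) × Uses (gate Y v) (port n l u)

  lastMeets-transport : ∀ l {Y Y'} → Y ≃ Y' → LastMeets l Y → LastMeets l Y'
  lastMeets-transport l {Y} {Y'} I (v , u , uses-last , uses-port) =
    onComps I ⟨$⟩ʳ v , onPorts I ⟨$⟩ʳ u ,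
    ⇒ (usesLast-preserved (suc t) {Y} {Y'} I v) uses-last , ⇒ (preserves I l u v) uses-port

  lift-not-lastMeets : ∀ l X → ¬ LastMeets l (lift {suc t} X)
  lift-not-lastMeets l X (v , _ , uses-last , _) = lift-avoids-last X v uses-last

  attach-lastMeets : ∀ l D → LastMeets l (attach l D)
  attach-lastMeets l D = zero , zero , ⇐ (uses-top l _) (inj₂ refl) , ⇐ (uses-top l _) (inj₁ refl)

  attach-not-lastMeets-flip : ∀ l D → ¬ LastMeets (flip l) (attach l D)
  attach-not-lastMeets-flip l D (zero , u , _ , uses-port) with ⇒ (uses-top l _) uses-port
  ... | inj₁ e = flip≢ l (sym (proj₁ (port-injective n {l} {flip l} {zero} {u} e)))
  ... | inj₂ e = port≢last (suc t) (flip l) u (sym e)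
  attach-not-lastMeets-flip l D (suc i , _ , uses-last , _) with only-top-usesLast l D (suc i) uses-last
  ... | ()

  lift≄attach : ∀ l X D → ¬ (lift X ≃ attach l D)
  lift≄attach l X D I =
    lift-not-lastMeets l X (lastMeets-transport l {attach l D} {lift X} (≅-sym I) (attach-lastMeets l D))

  attach≄attach : ∀ {l l'} D D' → l ≢ l' → ¬ (attach l D ≃ attach l' D')
  attach≄attach {l} {l'} D D' l≢l' I = attach-not-lastMeets-flip l' D'
    (subst (λ z → LastMeets z (attach l' D')) (other≡flip l≢l')
      (lastMeets-transport l {attach l D} {attach l' D'} I (attach-lastMeets l D)))

  -- A second layer on n channels in which comparator v0 joins the last channel to
  -- stacked port (l , x0) is attach l D, where D arises by deleting v0 and
  -- contracting comparator x0 of F_n, its output flip l becoming the last channel of D.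
  module Contract (N : ℕ) (c : Fin (suc N) → Comparator n)
    (c-disjoint : ∀ i j → i ≢ j → Disjoint (c i) (c j))
    (v0 : Fin (suc N)) (l : Label) (x0 : Fin (suc (pairs m')))
    (c-v0 : ∀ k → Uses (c v0) k ⇔ ((k ≡ last (suc t)) ⊎ (k ≡ stackedPort m' l x0))) where

    collapse : Label → Fin (suc (pairs m')) → Fin m'
    collapse l' x with x FinP.≟ x0
    ... | yes _ = last t
    ... | no x≢x0 = port m' l' (punchOut (x≢x0 ∘ sym))

    contract : Fin n → Fin m'
    contract k with classify k
    ... | inj₁ _ = last t
    ... | inj₂ (l' , x , _) = collapse l' x

    Free : Fin n → Set
    Free a = (a ≢ last (suc t)) × (a ≢ stackedPort m' l x0)

    Corresponds : Fin n → Fin m' → Set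
    Corresponds a k = (∀ l' y → (k ≡ port m' l' y) ⇔ (a ≡ stackedPort m' l' (punchIn x0 y))) ×
                      ((k ≡ last t) ⇔ (a ≡ stackedPort m' (flip l) x0))

    collapse-spec : ∀ la xa → stackedPort m' la xa ≢ stackedPort m' l x0 →
      Corresponds (stackedPort m' la xa) (collapse la xa)
    collapse-spec la xa not-v0 with xa FinP.≟ x0
    ... | yes refl =
      (λ l' y → mk⇔ (λ e → ⊥-elim (port≢last t l' y (sym e)))
                    (λ e → ⊥-elim (FinP.punchInᵢ≢i xa y (sym (proj₂ (stackedPort-injective m' {la} {l'} {xa} {punchIn xa y} e)))))) ,
      mk⇔ (λ _ → cong (λ z → stackedPort m' z xa) (other≡flip (not-v0 ∘ cong (λ z → stackedPort m' z xa))))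
          (λ _ → refl)
    ... | no xa≢x0 =
      (λ l' y → mk⇔ (toStacked l' y) (fromStacked l' y)) ,
      mk⇔ (λ e → ⊥-elim (port≢last t la _ e)) (λ e → ⊥-elim (xa≢x0 (proj₂ (stackedPort-injective m' {la} {flip l} {xa} {x0} e))))
      where
      toStacked : ∀ l' y → port m' la (punchOut (xa≢x0 ∘ sym)) ≡ port m' l' y →
                  stackedPort m' la xa ≡ stackedPort m' l' (punchIn x0 y)
      toStacked l' y e with port-injective m' {la} {l'} {punchOut (xa≢x0 ∘ sym)} {y} e
      ... | refl , same = cong (stackedPort m' la) (trans (sym (FinP.punchIn-punchOut _)) (cong (punchIn x0) same))
      fromStacked : ∀ l' y → stackedPort m' la xa ≡ stackedPort m' l' (punchIn x0 y) →
                    port m' la (punchOut (xa≢x0 ∘ sym)) ≡ port m' l' y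
      fromStacked l' y e with stackedPort-injective m' {la} {l'} {xa} {punchIn x0 y} e
      ... | refl , refl = cong (port m' la) (trans (FinP.punchOut-cong x0 refl) (FinP.punchOut-punchIn x0))

    -- On free channels, contract inverts merge l composed with the reindexing
    -- of ports y ↦ punchIn x0 y.
    contract-spec : ∀ a → Free a → Corresponds a (contract a)
    contract-spec a (not-last , not-v0) with classify a
    ... | inj₁ at-last = ⊥-elim (not-last at-last)
    ... | inj₂ (la , xa , refl) = collapse-spec la xa not-v0

    contract-injective : ∀ a b → Free a → Free b → contract a ≡ contract b → a ≡ b
    contract-injective a b free-a free-b e with contract a FinP.≟ last t
    ... | yes at-last = trans (⇒ (proj₂ (contract-spec a free-a)) at-last)
                              (sym (⇒ (proj₂ (contract-spec b free-b)) (trans (sym e) at-last)))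
    ... | no not-last with port-or-last t (contract a) not-last
    ...   | l' , y , at-port = trans (⇒ (proj₁ (contract-spec a free-a) l' y) (sym at-port))
                                     (sym (⇒ (proj₁ (contract-spec b free-b) l' y) (trans (sym e) (sym at-port))))

    free : ∀ w a → Uses (c (punchIn v0 w)) a → Free a
    free w a uses =
      (λ at-last → c-disjoint (punchIn v0 w) v0 (FinP.punchInᵢ≢i v0 w) a uses (⇐ (c-v0 a) (inj₁ at-last))) ,
      (λ at-port → c-disjoint (punchIn v0 w) v0 (FinP.punchInᵢ≢i v0 w) a uses (⇐ (c-v0 a) (inj₂ at-port)))

    contracted : Fin N → Comparator m'
    contracted w = relabel contract (c (punchIn v0 w)) λ e →
      FinP.<⇒≢ (lo<hi (c (punchIn v0 w))) (contract-injective _ _ (free w _ (inj₁ refl)) (free w _ (inj₂ refl)) e)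

    contracted-port : ∀ w l' y → Uses (contracted w) (port m' l' y) ⇔ Uses (c (punchIn v0 w)) (stackedPort m' l' (punchIn x0 y))
    contracted-port w l' y = uses-relabel-at contract (c (punchIn v0 w)) _
      (proj₁ (contract-spec _ (free w _ (inj₁ refl))) l' y) (proj₁ (contract-spec _ (free w _ (inj₂ refl))) l' y)

    contracted-last : ∀ w → Uses (contracted w) (last t) ⇔ Uses (c (punchIn v0 w)) (stackedPort m' (flip l) x0)
    contracted-last w = uses-relabel-at contract (c (punchIn v0 w)) _
      (proj₂ (contract-spec _ (free w _ (inj₁ refl)))) (proj₂ (contract-spec _ (free w _ (inj₂ refl))))

    D : Layer m'
    D = layer N contracted disjoint-contracted
      where
      disjoint-contracted : ∀ i j → i ≢ j → Disjoint (contracted i) (contracted j)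
      disjoint-contracted i j i≢j k with k FinP.≟ last t
      ... | yes refl = λ uses-i uses-j → c-disjoint (punchIn v0 i) (punchIn v0 j) (i≢j ∘ FinP.punchIn-injective v0 i j) _
                                           (⇒ (contracted-last i) uses-i) (⇒ (contracted-last j) uses-j)
      ... | no k≢last with port-or-last t k k≢last
      ...   | l' , y , refl = λ uses-i uses-j → c-disjoint (punchIn v0 i) (punchIn v0 j) (i≢j ∘ FinP.punchIn-injective v0 i j) _
                                                  (⇒ (contracted-port i l' y) uses-i) (⇒ (contracted-port j l' y) uses-j)

    Y : Layer n
    Y = layer (suc N) c c-disjoint

    incidences : ∀ l' x j → Incident (stacked (attach l D)) l' x j ⇔
      Incident (stacked Y) l' (Perm.insert zero x0 Perm.id ⟨$⟩ʳ x) (Perm.insert zero v0 Perm.id ⟨$⟩ʳ j)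
    incidences l' zero zero = mk⇔
      (λ uses → ⇐ (c-v0 _) (inj₂ (cong (λ z → stackedPort m' z x0) (⇒ (top-first l l') uses))))
      (λ uses → ⇐ (top-first l l') (onV0 (⇒ (c-v0 _) uses)))
      where
      onV0 : (stackedPort m' l' x0 ≡ last (suc t)) ⊎ (stackedPort m' l' x0 ≡ stackedPort m' l x0) → l' ≡ l
      onV0 (inj₁ at-last) = ⊥-elim (stackedPort≢last l' x0 at-last)
      onV0 (inj₂ at-port) = proj₁ (stackedPort-injective m' {l'} {l} {x0} {x0} at-port)
    incidences l' (suc y) zero = mk⇔ (⊥-elim ∘ top-shifted l l' y) (λ uses → ⊥-elim (notV0 (⇒ (c-v0 _) uses)))
      where
      notV0 : (stackedPort m' l' (punchIn x0 y) ≡ last (suc t)) ⊎ (stackedPort m' l' (punchIn x0 y) ≡ stackedPort m' l x0) → ⊥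
      notV0 (inj₁ at-last) = stackedPort≢last l' (punchIn x0 y) at-last
      notV0 (inj₂ at-port) = FinP.punchInᵢ≢i x0 y (proj₂ (stackedPort-injective m' {l'} {l} {punchIn x0 y} {x0} at-port))
    incidences l' zero (suc w) = mk⇔ toY fromY
      where
      toY : Uses (moved l (contracted w)) (output l' first) → Uses (c (punchIn v0 w)) (stackedPort m' l' x0)
      toY uses with ⇒ (moved-first l l' (contracted w)) uses
      ... | refl , uses-last = ⇒ (contracted-last w) uses-last
      fromY : Uses (c (punchIn v0 w)) (stackedPort m' l' x0) → Uses (moved l (contracted w)) (output l' first)
      fromY uses with l' ≟ᴸ l
      ... | yes refl = ⊥-elim (c-disjoint (punchIn v0 w) v0 (FinP.punchInᵢ≢i v0 w) _ uses (⇐ (c-v0 _) (inj₂ refl)))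
      ... | no l'≢l = ⇐ (moved-first l l' (contracted w)) (other≡flip l'≢l ,
              ⇐ (contracted-last w) (subst (λ z → Uses (c (punchIn v0 w)) (stackedPort m' z x0)) (other≡flip l'≢l) uses))
    incidences l' (suc y) (suc w) = ⇔.trans (moved-shifted l l' y (contracted w)) (contracted-port w l' y)

    Y≃attach : Y ≃ attach l D
    Y≃attach = ≅-trans (present≅stacked Y)
      (≅-trans (≅-sym (iso (Perm.insert zero x0 Perm.id) (Perm.insert zero v0 Perm.id) incidences))
               (≅-sym (present≅stacked (attach l D))))

  attach-cover : (Y : Layer n) (v0 : Fin (size Y)) → Uses (gate Y v0) (last (suc t)) →
    Σ Label λ l → Σ (Layer m') λ D → Y ≃ attach l D
  attach-cover (layer zero _ _) () _
  attach-cover (layer (suc N) c c-disjoint) v0 uses-last with partner (c v0) uses-last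
  ... | p , p≢last , c-v0 with classify p
  ...   | inj₁ p≡last = ⊥-elim (p≢last p≡last)
  ...   | inj₂ (l , x0 , refl) = l , Contract.D N c c-disjoint v0 l x0 c-v0 , Contract.Y≃attach N c c-disjoint v0 l x0 c-v0

  recurrence : ∀ {a b} → Classes (suc m') (Fin a) → Classes m' (Fin b) → Classes n (Fin a ⊎ (Label × Fin b))
  recurrence {a} {b} A B = classes r distinct cover
    where
    r : Fin a ⊎ (Label × Fin b) → Layer n
    r (inj₁ i) = lift (rep A i)
    r (inj₂ (l , j)) = attach l (rep B j)

    distinct : ∀ i j → r i ≃ r j → i ≡ j
    distinct (inj₁ i) (inj₁ i') I =
      cong inj₁ (rep-distinct A i i' (≅-trans (lift-≃ (rep A i)) (≅-trans I (≅-sym (lift-≃ (rep A i'))))))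
    distinct (inj₁ i) (inj₂ (l , j)) I = ⊥-elim (lift≄attach l (rep A i) (rep B j) I)
    distinct (inj₂ (l , j)) (inj₁ i) I = ⊥-elim (lift≄attach l (rep A i) (rep B j) (≅-sym I))
    distinct (inj₂ (l , j)) (inj₂ (l' , j')) I with l ≟ᴸ l'
    ... | yes refl = cong (λ z → inj₂ (l , z)) (rep-distinct B j j' (attach-reflect l {rep B j} {rep B j'} I))
    ... | no l≢l' = ⊥-elim (attach≄attach (rep B j) (rep B j') l≢l' I)

    cover : ∀ Y → Σ (Fin a ⊎ (Label × Fin b)) λ i → Y ≃ r i
    cover Y with FinP.any? (λ v → uses? (gate Y v) (last (suc t)))
    ... | yes (v0 , uses-last) =
      let (l , D , Y≃attach) = attach-cover Y v0 uses-last
          (j , D≃repⱼ) = rep-cover B D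
      in inj₂ (l , j) , ≅-trans Y≃attach (attach-resp l {D} {rep B j} D≃repⱼ)
    ... | no uses-last =
      let avoids = λ v uses → uses-last (v , uses)
          X = lower Y avoids
          (i , X≃repᵢ) = rep-cover A X
      in inj₁ i , ≅-trans (lower-≃ Y avoids) (≅-trans (≅-sym (lift-≃ X)) (≅-trans X≃repᵢ (lift-≃ (rep A i))))

Label↔Fin2 : Label ↔ Fin 2
Label↔Fin2 = mk↔ₛ′ toFin fromFin (λ { zero → refl ; (suc zero) → refl }) (λ { one → refl ; two → refl })
  where
  toFin : Label → Fin 2
  toFin one = zero
  toFin two = suc zero
  fromFin : Fin 2 → Label
  fromFin zero = one
  fromFin (suc zero) = two

recurrence-index : ∀ a b → (Fin a ⊎ (Label × Fin b)) ↔ Fin (a + 2 * b)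
recurrence-index a b = ↔-sym (↔-trans FinP.+↔⊎ (↔-refl ⊎-↔ ↔-trans FinP.*↔× (↔-sym Label↔Fin2 ×-↔ ↔-refl)))

double-mod-2 : ∀ q → double q % 2 ≡ 0
double-mod-2 zero = refl
double-mod-2 (suc q) = double-mod-2 q

odd-form : ∀ n → 3 ≤ n → n % 2 ≡ 1 → Σ ℕ λ t → n ≡ suc (suc (suc (double t)))
odd-form n 3≤n odd with halve n
... | one , q , refl with trans (sym (double-mod-2 q)) odd
...   | ()
odd-form n (s≤s ()) odd | two , zero , refl
odd-form n 3≤n odd | two , suc t , refl = t , refl

theorem2 : ∀ (n : ℕ) → 3 ≤ n → n % 2 ≡ 1 →
    (∃ (ClassCount n) × ∃ (ClassCount (n ∸ 1)) × ∃ (ClassCount (n ∸ 2))) ×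
    (∀ a b c → ClassCount n a → ClassCount (n ∸ 1) b → ClassCount (n ∸ 2) c →
      a ≡ b + 2 * c)
theorem2 n 3≤n odd with odd-form n 3≤n odd
... | t , refl = (count n , count (n ∸ 1) , count (n ∸ 2)) , λ a b c A B C →
  classes-unique (classCount⇒classes A)
    (classes-reindex (recurrence-index b c)
      (Attach.recurrence t (classCount⇒classes B) (classCount⇒classes C)))
  where
  count : ∀ m → ∃ (ClassCount m)
  count m = let (k , K) = classes-exist m in k , classes⇒classCount K
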